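{- Let $G_1,G_2$ be finite simple graphs and $G_1+G_2$ their disjoint union. Then the characteristic tree of $G_1+G_2$ is isomorphic to the product digraph $T(G_1)*T(G_2)$, and the loop ensemble of $G_1+G_2$ equals $L(G_1)*L(G_2)$ in $\mathcal{L}$.
   Context: For a finite simple graph $G$ with vertices $v_1,\dots,v_n$: the state space $\mathcal{V}_G\cong\mathbf{Z}_2^n$ is the set of vertex subsets with symmetric difference; the harmonic operator $a$ is the $\mathbf{Z}_2$-linear map with matrix $A+D\pmod 2$ ($A$ adjacency matrix, $D$ diagonal with $D_{ii}=1$ iff $v_i$ has odd degree). Let $k\ge0$, $m\ge1$ be minimal with $a^{k+m}=a^k$ and $\pi=a^{mk}$. The characteristic tree $T(G)$ is the digraph on $\operatorname{Ker}\pi$ with arcs $x\to ax$. The loop ensemble of $G$ is the digraph on $\operatorname{Im}\pi$ with arcs $x\to ax$, a disjoint union of directed cycles; it is recorded as the formal sum $L(G)=\sum_i n_iL_i$, $n_i$ the number of cycles of length $i$. For digraphs $A,B$ with exactly one out-arc per vertex, $A*B$ has vertex set $A\times B$ and arcs $(x,y)\to(x',y')$ iff $x\to x'$ and $y\to y'$. $\mathcal{L}$ is the set of formal finite sums $\sum n_iL_i$ ($n_i\in\mathbf{N}$) with product defined by $L_a*L_b=\gcd(a,b)L_{\operatorname{lcm}(a,b)}$ extended bilinearly. -}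

module Defs where

open import Data.Bool using (Bool; true; false; _xor_; _∧_; not; if_then_else_; T; T?)
open import Data.Bool.Properties using () renaming (_≟_ to _≟B_)
open import Data.Nat using (ℕ; zero; suc; _+_; _*_; _≤_; _/_)
import Data.Nat
import Data.Fin as Fin
open import Data.Nat.GCD using (gcd)
open import Data.Nat.LCM using (lcm)
open import Data.Fin using (Fin; splitAt)
open import Data.Fin.Properties using () renaming (_≟_ to _≟F_)
open import Data.Vec using (Vec; []; _∷_; lookup; tabulate; replicate)
open import Data.Vec.Properties using (≡-dec)
open import Data.List using (List; []; _∷_; map; _++_; filter; length; foldr; upTo)
open import Data.Bool.ListAction using (any; all)
open import Data.Sum using (inj₁; inj₂)
open import Data.Product using (Σ; _×_; _,_)
open import Function using (Inverse; _↔_; _⇔_)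
open import Function.Bundles using (Equivalence)
open import Relation.Binary.PropositionalEquality using (_≡_)
open import Relation.Nullary using (¬_)
open import Relation.Nullary.Decidable using (⌊_⌋)

record Graph (n : ℕ) : Set where
  field adj : Fin n → Fin n → Bool
open Graph public

record Simple {n : ℕ} (G : Graph n) : Set where
  field
    symm    : ∀ i j → adj G i j ≡ adj G j i
    noLoops : ∀ i → adj G i i ≡ false

_⊕_ : ∀ {n₁ n₂} → Graph n₁ → Graph n₂ → Graph (n₁ + n₂)
adj (_⊕_ {n₁} G₁ G₂) i j with splitAt n₁ i | splitAt n₁ j
... | inj₁ i₁ | inj₁ j₁ = adj G₁ i₁ j₁
... | inj₂ i₂ | inj₂ j₂ = adj G₂ i₂ j₂
... | inj₁ _  | inj₂ _  = false
... | inj₂ _  | inj₁ _  = false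

-- State space V_G ≅ Z₂ⁿ : Boolean vectors (xor = symmetric difference).

State : ℕ → Set
State n = Vec Bool n

zeroState : ∀ n → State n
zeroState n = replicate n false

xorSum : ∀ {n} → (Fin n → Bool) → Bool
xorSum {zero}  f = false
xorSum {suc n} f = f Fin.zero xor xorSum (λ i → f (Fin.suc i))

oddDeg : ∀ {n} → Graph n → Fin n → Bool
oddDeg G i = xorSum (λ j → adj G i j)

harmMatrix : ∀ {n} → Graph n → Fin n → Fin n → Bool
harmMatrix G i j = adj G i j xor (⌊ i ≟F j ⌋ ∧ oddDeg G i)

harm : ∀ {n} → Graph n → State n → State n
harm G x = tabulate (λ i → xorSum (λ j → harmMatrix G i j ∧ lookup x j))

iter : ∀ {A : Set} → ℕ → (A → A) → A → A
iter zero    f x = x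
iter (suc k) f x = f (iter k f x)

PowEq : ∀ {n} → Graph n → ℕ → ℕ → Set
PowEq {n} G k m = ∀ (x : State n) → iter (k + m) (harm G) x ≡ iter k (harm G) x

record IsMinPreperiodPeriod {n} (G : Graph n) (k m : ℕ) : Set where
  field
    m≥1     : 1 ≤ m
    powEq   : PowEq G k m
    minimal : ∀ k′ m′ → 1 ≤ m′ → PowEq G k′ m′ → k ≤ k′ × m ≤ m′

proj : ∀ {n} → Graph n → (k m : ℕ) → State n → State n
proj G k m = iter (m * k) (harm G)

record Digraph : Set₁ where
  field
    Vtx : Set
    Arc : Vtx → Vtx → Set
open Digraph public

_≅_ : Digraph → Digraph → Set
D ≅ E = Σ (Vtx D ↔ Vtx E) λ f →
          ∀ x y → Arc D x y ⇔ Arc E (Inverse.to f x) (Inverse.to f y)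

_⊗_ : Digraph → Digraph → Digraph
Vtx (D ⊗ E) = Vtx D × Vtx E
Arc (D ⊗ E) (x , y) (x′ , y′) = Arc D x x′ × Arc E y y′

charTree : ∀ {n} → Graph n → (k m : ℕ) → Digraph
Vtx (charTree {n} G k m) = Σ (State n) λ x → proj G k m x ≡ zeroState n
Arc (charTree G k m) (x , _) (y , _) = harm G x ≡ y

-- An element Σ nᵢ Lᵢ of 𝓛 is given by its coefficient function i ↦ nᵢ
-- (the coefficient at index 0 is meaningless and kept equal to 0).
Ens : Set
Ens = ℕ → ℕ

sum1to : ℕ → (ℕ → ℕ) → ℕ
sum1to zero    f = 0
sum1to (suc c) f = sum1to c f + f (suc c)

-- L_a * L_b = gcd(a,b) L_lcm(a,b), extended bilinearly; since a,b ∣ lcm(a,b)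
-- only a,b ∈ {1..c} contribute to the coefficient of L_c.
_⊛_ : Ens → Ens → Ens
(A ⊛ B) zero = 0
(A ⊛ B) (suc c) =
  sum1to (suc c) λ a → sum1to (suc c) λ b →
    if ⌊ lcm a b Data.Nat.≟ suc c ⌋ then gcd a b * A a * B b else 0

allStates : ∀ n → List (State n)
allStates zero    = [] ∷ []
allStates (suc n) = map (true ∷_) (allStates n) ++ map (false ∷_) (allStates n)

_==_ : ∀ {n} → State n → State n → Bool
x == y = ⌊ ≡-dec _≟B_ x y ⌋

inImage : ∀ {n} → Graph n → (k m : ℕ) → State n → Bool
inImage {n} G k m x = any (λ y → proj G k m y == x) (allStates n)

exactPeriod : ∀ {n} → Graph n → ℕ → State n → Bool
exactPeriod G zero    x = false
exactPeriod G (suc i) x =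
  (iter (suc i) (harm G) x == x) ∧
  all (λ j → not (iter (suc j) (harm G) x == x)) (upTo i)

loopVertices : ∀ {n} → Graph n → (k m : ℕ) → ℕ → ℕ
loopVertices {n} G k m i =
  length (filter (λ x → T? (inImage G k m x ∧ exactPeriod G i x)) (allStates n))

-- L(G) = Σ nᵢ Lᵢ, nᵢ = number of cycles of length i = (#vertices on them)/i
loopEnsemble : ∀ {n} → Graph n → (k m : ℕ) → Ens
loopEnsemble G k m zero    = 0
loopEnsemble G k m (suc i) = loopVertices G k m (suc i) / suc i

module Submission where

-- Listing the vertices of G₁ + G₂ as those of G₁ followed by those of G₂ makes A + D block
-- diagonal, so a (x ++ y) = a₁ x ++ a₂ y. Hence aʲ (x ++ y) = 0 iff a₁ʲ x = 0 and a₂ʲ y = 0;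
-- as Ker aᴷ stops changing once K exceeds the preperiod, and the exponent mk of π exceeds
-- k, k₁ and k₂, Ker π splits as Ker π₁ × Ker π₂, compatibly with the arcs x → a x.
-- For the loops, x ++ y has exact period lcm(p, q) when x and y have exact periods p and q,
-- so the number V(c) of states of exact period c is the sum of V₁(a) V₂(b) over lcm(a, b) = c.
-- Every periodic state lies in Im π, and the states of exact period a fall into orbits of
-- size a, so nₐ = V(a) / a exactly; multiplying the coefficient of L_c in L(G₁) * L(G₂)
-- by c = lcm(a, b) turns gcd(a, b) nₐ n_b into V₁(a) V₂(b).

open import Defs
open import Axiom.UniquenessOfIdentityProofs using (module Decidable⇒UIP)
open import Data.Bool using (Bool; true; false; _xor_; _∧_; _∨_; not; if_then_else_; T; T?)
open import Data.Bool.Properties using (xor-identityʳ; xor-assoc; ∧-zeroʳ; T-∧; T-∨)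
  renaming (_≟_ to _≟ᴮ_)
open import Data.Empty using (⊥-elim)
open import Data.Fin using (Fin; _↑ˡ_; _↑ʳ_; splitAt)
open import Data.Fin.Properties using (splitAt-↑ˡ; splitAt-↑ʳ; ↑ˡ-injective; ↑ʳ-injective)
  renaming (_≟_ to _≟ᶠ_)
open import Data.List using (List; []; _∷_; map; filter; length; upTo) renaming (_++_ to _++ᴸ_)
open import Data.List.Membership.Propositional using (_∈_; lose)
open import Data.List.Membership.Propositional.Properties
  using (∈-map⁺; ∈-++⁺ˡ; ∈-++⁺ʳ; ∈-upTo⁺; ∈-upTo⁻)
open import Data.List.Relation.Unary.All as All using ()
open import Data.List.Relation.Unary.All.Properties using (all⁺; all⁻)
open import Data.List.Relation.Unary.Any using (here)
open import Data.List.Relation.Unary.Any.Properties using (any⁺)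
open import Data.Nat
open import Data.Nat.Properties
open import Data.Nat.DivMod using (m≡m%n+[m/n]*n; m%n<n; m*n/n≡m; m/n*n≡m)
open import Data.Nat.Divisibility
  using (_∣_; divides; m%n≡0⇒n∣m; ∣⇒≤; ∣-antisym; ∣-refl; ∣m∣n⇒∣m+n; _∣0; m∣m*n)
open import Data.Nat.GCD using (gcd)
open import Data.Nat.Induction using (<-wellFounded)
open import Data.Nat.LCM using (lcm; m∣lcm[m,n]; n∣lcm[m,n]; lcm-least; gcd*lcm)
open import Data.Nat.Tactic.RingSolver using (solve-∀)
open import Data.Product using (Σ; ∃; ∃₂; _×_; _,_; proj₁; proj₂)
open import Data.Sum using (inj₁; inj₂; [_,_]′)
open import Data.Vec using (Vec; []; _∷_; _++_; lookup; tabulate; replicate; take; drop)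
open import Data.Vec.Properties
  using (≡-dec; ++-injective; lookup-++ˡ; lookup-++ʳ; lookup-replicate; tabulate-cong;
         take++drop≡id)
open import Function using (_∘_; _⇔_; Equivalence)
open import Function.Bundles using (mk⇔; mk↔ₛ′)
open import Induction.WellFounded using (Acc; acc)
open import Relation.Binary.Definitions using (DecidableEquality)
open import Relation.Binary.PropositionalEquality
open import Relation.Nullary using (¬_; Dec; yes; no; does; contradiction)
open import Relation.Nullary.Decidable
  using (⌊_⌋; _×-dec_; isYes≗does; does-⇔; dec-false; decidable-stable;
         toWitness; fromWitness; toWitnessFalse; fromWitnessFalse)
open import Algebra.Properties.CommutativeSemigroup +-commutativeSemigroup using (interchange)

open ≡-Reasoning

𝟙 : Bool → ℕ
𝟙 true  = 1
𝟙 false = 0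

𝟙-true : ∀ {b} → T b → 𝟙 b ≡ 1
𝟙-true {true} _ = refl

𝟙-∨ : ∀ a b → ¬ (T a × T b) → 𝟙 (a ∨ b) ≡ 𝟙 a + 𝟙 b
𝟙-∨ true  true  disjoint = ⊥-elim (disjoint _)
𝟙-∨ true  false _        = refl
𝟙-∨ false b     _        = refl

𝟙-∧-not : ∀ a b → 𝟙 a ≡ 𝟙 (a ∧ not b) + 𝟙 (a ∧ b)
𝟙-∧-not true  true  = refl
𝟙-∧-not true  false = refl
𝟙-∧-not false b     = refl

𝟙-∧-redundant : ∀ a b → (T b → T a) → 𝟙 (a ∧ b) ≡ 𝟙 b
𝟙-∧-redundant a     false _   = cong 𝟙 (∧-zeroʳ a)
𝟙-∧-redundant true  true  _   = refl
𝟙-∧-redundant false true  b⇒a = ⊥-elim (b⇒a _)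

T-∧-not : ∀ a b → T (a ∧ not b) ⇔ (T a × ¬ T b)
T-∧-not true  true  = mk⇔ (λ ()) (λ (_ , ¬b) → ¬b _)
T-∧-not true  false = mk⇔ (λ _ → _ , λ ()) (λ _ → _)
T-∧-not false b     = mk⇔ (λ ()) proj₁

𝟙*𝟙*𝟙≡0 : ∀ a b c → ¬ (T a × T b × T c) → 𝟙 a * (𝟙 b * 𝟙 c) ≡ 0
𝟙*𝟙*𝟙≡0 true  true  true  ¬abc = ⊥-elim (¬abc _)
𝟙*𝟙*𝟙≡0 true  true  false _    = refl
𝟙*𝟙*𝟙≡0 true  false c     _    = refl
𝟙*𝟙*𝟙≡0 false b     c     _    = refl

does-sound : ∀ {P : Set} (P? : Dec P) → T (does P?) → P
does-sound (yes p) _ = p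

does-complete : ∀ {P : Set} (P? : Dec P) → P → T (does P?)
does-complete (yes _) _ = _
does-complete (no ¬p) p = ¬p p

private variable
  A B : Set

sumOver : List A → (A → ℕ) → ℕ
sumOver []       g = 0
sumOver (x ∷ xs) g = g x + sumOver xs g

sumOver-cong : ∀ xs {g h : A → ℕ} → (∀ x → g x ≡ h x) → sumOver xs g ≡ sumOver xs h
sumOver-cong []       g≗h = refl
sumOver-cong (x ∷ xs) g≗h = cong₂ _+_ (g≗h x) (sumOver-cong xs g≗h)

sumOver-0 : ∀ xs {g : A → ℕ} → (∀ x → g x ≡ 0) → sumOver xs g ≡ 0
sumOver-0 []       g≗0 = refl
sumOver-0 (x ∷ xs) g≗0 = cong₂ _+_ (g≗0 x) (sumOver-0 xs g≗0)

sumOver-+ : ∀ xs (g h : A → ℕ) → sumOver xs (λ x → g x + h x) ≡ sumOver xs g + sumOver xs h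
sumOver-+ []       g h = refl
sumOver-+ (x ∷ xs) g h =
  trans (cong (g x + h x +_) (sumOver-+ xs g h)) (interchange (g x) (h x) _ _)

sumOver-*ˡ : ∀ xs c (g : A → ℕ) → sumOver xs (λ x → c * g x) ≡ c * sumOver xs g
sumOver-*ˡ []       c g = sym (*-zeroʳ c)
sumOver-*ˡ (x ∷ xs) c g =
  trans (cong (c * g x +_) (sumOver-*ˡ xs c g)) (sym (*-distribˡ-+ c (g x) _))

sumOver-++ : ∀ xs ys (g : A → ℕ) → sumOver (xs ++ᴸ ys) g ≡ sumOver xs g + sumOver ys g
sumOver-++ []       ys g = refl
sumOver-++ (x ∷ xs) ys g = trans (cong (g x +_) (sumOver-++ xs ys g)) (sym (+-assoc (g x) _ _))

sumOver-map : ∀ (h : B → A) (xs : List B) (g : A → ℕ) →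
  sumOver (map h xs) g ≡ sumOver xs (g ∘ h)
sumOver-map h []       g = refl
sumOver-map h (x ∷ xs) g = cong (g (h x) +_) (sumOver-map h xs g)

length-filter-T? : ∀ (b : A → Bool) xs → length (filter (T? ∘ b) xs) ≡ sumOver xs (𝟙 ∘ b)
length-filter-T? b []       = refl
length-filter-T? b (x ∷ xs) with b x
... | true  = cong suc (length-filter-T? b xs)
... | false = length-filter-T? b xs

sumOver-𝟙-witness : ∀ xs (b : A → Bool) → sumOver xs (𝟙 ∘ b) ≢ 0 → ∃ λ x → T (b x)
sumOver-𝟙-witness []       b nonzero = contradiction refl nonzero
sumOver-𝟙-witness (x ∷ xs) b nonzero with b x in bx
... | true  = x , subst T (sym bx) _
... | false = sumOver-𝟙-witness xs b nonzero

sum1to-cong : ∀ c {f g : ℕ → ℕ} → (∀ {a} → 0 < a → a ≤ c → f a ≡ g a) →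
  sum1to c f ≡ sum1to c g
sum1to-cong zero    f≗g = refl
sum1to-cong (suc c) f≗g =
  cong₂ _+_ (sum1to-cong c λ a>0 a≤c → f≗g a>0 (m≤n⇒m≤1+n a≤c)) (f≗g z<s ≤-refl)

sum1to-0 : ∀ c {f : ℕ → ℕ} → (∀ {a} → 0 < a → a ≤ c → f a ≡ 0) → sum1to c f ≡ 0
sum1to-0 zero    f≗0 = refl
sum1to-0 (suc c) f≗0 =
  cong₂ _+_ (sum1to-0 c λ a>0 a≤c → f≗0 a>0 (m≤n⇒m≤1+n a≤c)) (f≗0 z<s ≤-refl)

sum1to-concentrated : ∀ c {p} {f : ℕ → ℕ} → 0 < p → p ≤ c →
  (∀ {a} → 0 < a → a ≤ c → a ≢ p → f a ≡ 0) → sum1to c f ≡ f p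
sum1to-concentrated zero    p>0 p≤0 _ = contradiction p≤0 (<⇒≱ p>0)
sum1to-concentrated (suc c) {p} {f} p>0 p≤1+c f≗0 with m≤n⇒m<n∨m≡n p≤1+c
... | inj₁ p<1+c = begin
  sum1to c f + f (suc c) ≡⟨ cong₂ _+_ (sum1to-concentrated c p>0 (≤-pred p<1+c) λ a>0 a≤c →
                                         f≗0 a>0 (m≤n⇒m≤1+n a≤c))
                                      (f≗0 z<s ≤-refl (>⇒≢ p<1+c)) ⟩
  f p + 0                ≡⟨ +-identityʳ (f p) ⟩
  f p                    ∎
... | inj₂ refl = cong (_+ f (suc c)) (sum1to-0 c λ a>0 a≤c →
                    f≗0 a>0 (m≤n⇒m≤1+n a≤c) (<⇒≢ (s≤s a≤c)))

sum1to-*ˡ : ∀ c k (f : ℕ → ℕ) → sum1to c (λ a → k * f a) ≡ k * sum1to c f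
sum1to-*ˡ zero    k f = sym (*-zeroʳ k)
sum1to-*ˡ (suc c) k f =
  trans (cong (_+ k * f (suc c)) (sum1to-*ˡ c k f)) (sym (*-distribˡ-+ k _ (f (suc c))))

sum1to-+ : ∀ c (f g : ℕ → ℕ) → sum1to c (λ a → f a + g a) ≡ sum1to c f + sum1to c g
sum1to-+ zero    f g = refl
sum1to-+ (suc c) f g = trans (cong (_+ (f (suc c) + g (suc c))) (sum1to-+ c f g))
                             (interchange (sum1to c f) (sum1to c g) (f (suc c)) (g (suc c)))

sumOver-sum1to-comm : ∀ xs c (g : A → ℕ → ℕ) →
  sumOver xs (λ x → sum1to c (g x)) ≡ sum1to c (λ a → sumOver xs (λ x → g x a))
sumOver-sum1to-comm []       c g = sym (sum1to-0 c λ _ _ → refl)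
sumOver-sum1to-comm (x ∷ xs) c g =
  trans (cong (sum1to c (g x) +_) (sumOver-sum1to-comm xs c g)) (sym (sum1to-+ c (g x) _))

sumOver-sum1to²-comm : ∀ xs c (g : A → ℕ → ℕ → ℕ) →
  sumOver xs (λ x → sum1to c λ a → sum1to c (g x a)) ≡
  sum1to c λ a → sum1to c λ b → sumOver xs λ x → g x a b
sumOver-sum1to²-comm xs c g = trans (sumOver-sum1to-comm xs c _)
  (sum1to-cong c λ {a} _ _ → sumOver-sum1to-comm xs c λ x → g x a)

sumOver-*-sumOver : ∀ (xs : List A) (ys : List B) d (u : A → ℕ) (v : B → ℕ) →
  sumOver xs (λ x → sumOver ys λ y → d * (u x * v y)) ≡ d * (sumOver xs u * sumOver ys v)
sumOver-*-sumOver xs ys d u v = begin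
  sumOver xs (λ x → sumOver ys λ y → d * (u x * v y))
    ≡⟨ sumOver-cong xs (λ x → trans (sumOver-cong ys λ y → sym (*-assoc d (u x) (v y)))
                                    (sumOver-*ˡ ys (d * u x) v)) ⟩
  sumOver xs (λ x → d * u x * V)  ≡⟨ sumOver-cong xs (λ x → swap d (u x) V) ⟩
  sumOver xs (λ x → d * V * u x)  ≡⟨ sumOver-*ˡ xs (d * V) u ⟩
  d * V * sumOver xs u            ≡⟨ swap′ d V (sumOver xs u) ⟩
  d * (sumOver xs u * V)          ∎
  where
  V = sumOver ys v
  swap : ∀ d u V → d * u * V ≡ d * V * u
  swap = solve-∀
  swap′ : ∀ d V U → d * V * U ≡ d * (U * V)
  swap′ = solve-∀

lcm-positive : ∀ {p q} → 0 < p → 0 < q → 0 < lcm p q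
lcm-positive {p} {q} p>0 q>0 = n≢0⇒n>0 λ lcm≡0 →
  [ >⇒≢ p>0 , >⇒≢ q>0 ]′ (m*n≡0⇒m≡0∨n≡0 p (begin
    p * q                 ≡⟨ gcd*lcm p q ⟨
    gcd p q * lcm p q     ≡⟨ cong (gcd p q *_) lcm≡0 ⟩
    gcd p q * 0           ≡⟨ *-zeroʳ (gcd p q) ⟩
    0                     ∎))

lcm*gcd*quotients : ∀ a b {u v} .{{_ : NonZero a}} .{{_ : NonZero b}} → a ∣ u → b ∣ v →
  lcm a b * (gcd a b * (u / a) * (v / b)) ≡ u * v
lcm*gcd*quotients a b {u} {v} a∣u b∣v = begin
  lcm a b * (gcd a b * (u / a) * (v / b)) ≡⟨ regroup (lcm a b) (gcd a b) (u / a) (v / b) ⟩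
  gcd a b * lcm a b * (u / a * (v / b))   ≡⟨ cong (_* (u / a * (v / b))) (gcd*lcm a b) ⟩
  a * b * (u / a * (v / b))               ≡⟨ interleave a b (u / a) (v / b) ⟩
  u / a * a * (v / b * b)                 ≡⟨ cong₂ _*_ (m/n*n≡m a∣u) (m/n*n≡m b∣v) ⟩
  u * v                                   ∎
  where
  regroup : ∀ l g x y → l * (g * x * y) ≡ g * l * (x * y)
  regroup = solve-∀
  interleave : ∀ a b x y → a * b * (x * y) ≡ x * a * (y * b)
  interleave = solve-∀

-- Iterating a self-map

module Iteration (f : A → A) where

  iter-+ : ∀ i j x → iter (i + j) f x ≡ iter i f (iter j f x)
  iter-+ zero    j x = refl
  iter-+ (suc i) j x = cong f (iter-+ i j x)

  iter-∸ : ∀ {i j} → j ≤ i → ∀ x → iter i f x ≡ iter (i ∸ j) f (iter j f x)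
  iter-∸ {i} {j} j≤i x =
    trans (cong (λ t → iter t f x) (sym (m∸n+n≡m j≤i))) (iter-+ (i ∸ j) j x)

  iter-comm : ∀ i j x → iter i f (iter j f x) ≡ iter j f (iter i f x)
  iter-comm i j x = begin
    iter i f (iter j f x) ≡⟨ iter-+ i j x ⟨
    iter (i + j) f x      ≡⟨ cong (λ t → iter t f x) (+-comm i j) ⟩
    iter (j + i) f x      ≡⟨ iter-+ j i x ⟩
    iter j f (iter i f x) ∎

  iter-fixed : ∀ {z} → f z ≡ z → ∀ t → iter t f z ≡ z
  iter-fixed fz≡z zero    = refl
  iter-fixed fz≡z (suc t) = trans (cong f (iter-fixed fz≡z t)) fz≡z

  Periodic : ℕ → A → Set
  Periodic p x = iter p f x ≡ x

  periodic-iter : ∀ {p x} → Periodic p x → ∀ i → Periodic p (iter i f x)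
  periodic-iter {p} {x} px i = trans (iter-comm p i x) (cong (iter i f) px)

  periodic-* : ∀ {p x} → Periodic p x → ∀ t → Periodic (t * p) x
  periodic-*         px zero    = refl
  periodic-* {p} {x} px (suc t) =
    trans (iter-+ p (t * p) x) (trans (cong (iter p f) (periodic-* px t)) px)

  periodic-∣ : ∀ {p j x} → Periodic p x → p ∣ j → Periodic j x
  periodic-∣ px (divides t refl) = periodic-* px t

  periodic-% : ∀ {p x} .{{_ : NonZero p}} → Periodic p x →
               ∀ j → iter j f x ≡ iter (j % p) f x
  periodic-% {p} {x} px j = begin
    iter j f x                            ≡⟨ cong (λ t → iter t f x) (m≡m%n+[m/n]*n j p) ⟩
    iter (j % p + j / p * p) f x          ≡⟨ iter-+ (j % p) (j / p * p) x ⟩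
    iter (j % p) f (iter (j / p * p) f x) ≡⟨ cong (iter (j % p) f) (periodic-* px (j / p)) ⟩
    iter (j % p) f x                      ∎

  periodic-return : ∀ {p x i} → i ≤ p → Periodic p x → iter (p ∸ i) f (iter i f x) ≡ x
  periodic-return i≤p px = trans (sym (iter-∸ i≤p _)) px

  periodic-∈-image : ∀ {p x} → Periodic (suc p) x → ∀ N → iter N f (iter (p * N) f x) ≡ x
  periodic-∈-image {p} {x} px N =
    trans (sym (iter-+ N (p * N) x)) (periodic-∣ {suc p} px (m∣m*n N))

  record ExactPeriod (p : ℕ) (x : A) : Set where
    field
      period>0 : 0 < p
      periodic : Periodic p x
      minimal  : ∀ {j} → 0 < j → j < p → ¬ Periodic j x

  exactPeriod-∣ : ∀ {p j x} → ExactPeriod p x → Periodic j x → p ∣ j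
  exactPeriod-∣ {p} {j} {x} ep xj = m%n≡0⇒n∣m j p remainder≡0
    where
    open ExactPeriod ep
    instance
      p≢0 : NonZero p
      p≢0 = >-nonZero period>0
    remainder≡0 : j % p ≡ 0
    remainder≡0 = decidable-stable (j % p ≟ 0) λ r≢0 →
      minimal (n≢0⇒n>0 r≢0) (m%n<n j p) (trans (sym (periodic-% periodic j)) xj)

  exactPeriod-unique : ∀ {p q x} → ExactPeriod p x → ExactPeriod q x → p ≡ q
  exactPeriod-unique ep eq = ∣-antisym (exactPeriod-∣ ep (ExactPeriod.periodic eq))
                                       (exactPeriod-∣ eq (ExactPeriod.periodic ep))

  exactPeriod-iter : ∀ {p x} → ExactPeriod p x → ∀ i → ExactPeriod p (iter i f x)
  exactPeriod-iter {p} {x} ep i = record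
    { period>0 = period>0
    ; periodic = periodic-iter {p} periodic i
    ; minimal  = λ {j} j>0 j<p yj →
        minimal j>0 j<p (subst (Periodic j) x-from-iterate (periodic-iter {j} yj (i * p ∸ i)))
    }
    where
    open ExactPeriod ep
    x-from-iterate : iter (i * p ∸ i) f (iter i f x) ≡ x
    x-from-iterate = periodic-return (m≤m*n i p {{>-nonZero period>0}}) (periodic-* {p} periodic i)

  exactPeriod-exists : DecidableEquality A → ∀ {N x} → 0 < N → Periodic N x →
                       ∃ λ p → ExactPeriod p x
  exactPeriod-exists _≟ᴬ_ {N} {x} = search (<-wellFounded N)
    where
    search : ∀ {N} → Acc _<_ N → 0 < N → Periodic N x → ∃ λ p → ExactPeriod p x
    search {N} (acc smaller) N>0 xN with anyUpTo? (λ j → 0 <? j ×-dec iter j f x ≟ᴬ x) N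
    ... | yes (j , j<N , j>0 , xj) = search (smaller j<N) j>0 xj
    ... | no none = N , record
      { period>0 = N>0
      ; periodic = xN
      ; minimal  = λ j>0 j<N xj → none (_ , j<N , j>0 , xj)
      }

  -- fᵏ x is m-periodic, so it recurs as f^(K m + k) x, which lies beyond fᴷ x = z.
  eventually-fixed : ∀ {k m z} → 0 < m → (∀ x → iter (k + m) f x ≡ iter k f x) →
                     f z ≡ z → ∀ K x {K′} → iter K f x ≡ z → k ≤ K′ → iter K′ f x ≡ z
  eventually-fixed {k} {m} {z} m>0 powEq fz≡z K x {K′} xK≡z k≤K′ = begin
    iter K′ f x                  ≡⟨ iter-∸ k≤K′ x ⟩
    iter (K′ ∸ k) f (iter k f x) ≡⟨ cong (iter (K′ ∸ k) f) xk≡z ⟩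
    iter (K′ ∸ k) f z            ≡⟨ iter-fixed fz≡z (K′ ∸ k) ⟩
    z                            ∎
    where
    xk-periodic : Periodic m (iter k f x)
    xk-periodic =
      trans (sym (iter-+ m k x)) (trans (cong (λ t → iter t f x) (+-comm m k)) (powEq x))
    K≤ : K ≤ K * m + k
    K≤ = ≤-trans (m≤m*n K m {{>-nonZero m>0}}) (m≤m+n (K * m) k)
    xk≡z : iter k f x ≡ z
    xk≡z = begin
      iter k f x                          ≡⟨ periodic-* xk-periodic K ⟨
      iter (K * m) f (iter k f x)         ≡⟨ iter-+ (K * m) k x ⟨
      iter (K * m + k) f x                ≡⟨ iter-∸ K≤ x ⟩
      iter (K * m + k ∸ K) f (iter K f x) ≡⟨ cong (iter (K * m + k ∸ K) f) xK≡z ⟩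
      iter (K * m + k ∸ K) f z            ≡⟨ iter-fixed fz≡z (K * m + k ∸ K) ⟩
      z                                   ∎

module Product {C : Set} (f : A → A) (g : B → B) (h : C → C)
  (_⊕_ : A → B → C)
  (⊕-injective : ∀ {x x′ y y′} → x ⊕ y ≡ x′ ⊕ y′ → x ≡ x′ × y ≡ y′)
  (iter-⊕ : ∀ t x y → iter t h (x ⊕ y) ≡ iter t f x ⊕ iter t g y) where

  private
    module F = Iteration f
    module G = Iteration g
    module H = Iteration h

  iterEq-⊕ˡ : ∀ i j → B → (∀ z → iter i h z ≡ iter j h z) →
              ∀ x → iter i f x ≡ iter j f x
  iterEq-⊕ˡ i j y eq x =
    proj₁ (⊕-injective (trans (sym (iter-⊕ i x y)) (trans (eq (x ⊕ y)) (iter-⊕ j x y))))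

  iterEq-⊕ʳ : ∀ i j → A → (∀ z → iter i h z ≡ iter j h z) →
              ∀ y → iter i g y ≡ iter j g y
  iterEq-⊕ʳ i j x eq y =
    proj₂ (⊕-injective (trans (sym (iter-⊕ i x y)) (trans (eq (x ⊕ y)) (iter-⊕ j x y))))

  periodic-⊕⁻ : ∀ {j x y} → H.Periodic j (x ⊕ y) → F.Periodic j x × G.Periodic j y
  periodic-⊕⁻ {j} {x} {y} per = ⊕-injective (trans (sym (iter-⊕ j x y)) per)

  periodic-⊕⁺ : ∀ {j x y} → F.Periodic j x → G.Periodic j y → H.Periodic j (x ⊕ y)
  periodic-⊕⁺ {j} {x} {y} perˣ perʸ = trans (iter-⊕ j x y) (cong₂ _⊕_ perˣ perʸ)

  exactPeriod-⊕ : ∀ {p q x y} → F.ExactPeriod p x → G.ExactPeriod q y →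
                  H.ExactPeriod (lcm p q) (x ⊕ y)
  exactPeriod-⊕ {p} {q} {x} {y} epˣ epʸ = record
    { period>0 = lcm-positive (F.ExactPeriod.period>0 epˣ) (G.ExactPeriod.period>0 epʸ)
    ; periodic = periodic-⊕⁺ {lcm p q}
        (F.periodic-∣ {p} (F.ExactPeriod.periodic epˣ) (m∣lcm[m,n] p q))
        (G.periodic-∣ {q} (G.ExactPeriod.periodic epʸ) (n∣lcm[m,n] p q))
    ; minimal  = λ {j} j>0 j<lcm per → let perˣ , perʸ = periodic-⊕⁻ {j} per in
        <⇒≱ j<lcm (∣⇒≤ {{>-nonZero j>0}}
                       (lcm-least (F.exactPeriod-∣ epˣ perˣ) (G.exactPeriod-∣ epʸ perʸ)))
    }

  exactPeriod-⊕⁻ : DecidableEquality A → DecidableEquality B →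
    ∀ {c x y} → H.ExactPeriod c (x ⊕ y) →
    ∃₂ λ p q → F.ExactPeriod p x × G.ExactPeriod q y × lcm p q ≡ c
  exactPeriod-⊕⁻ _≟ᴬ_ _≟ᴮ_ {c} ep
    with perˣ , perʸ ← periodic-⊕⁻ {c} (H.ExactPeriod.periodic ep)
    with p , epˣ ← F.exactPeriod-exists _≟ᴬ_ (H.ExactPeriod.period>0 ep) perˣ
       | q , epʸ ← G.exactPeriod-exists _≟ᴮ_ (H.ExactPeriod.period>0 ep) perʸ
    = p , q , epˣ , epʸ , H.exactPeriod-unique (exactPeriod-⊕ epˣ epʸ) ep

-- Orbits of periodic points

module OrbitCounting (_≟ᴬ_ : DecidableEquality A) (L : List A)
  (enumerates : ∀ a → sumOver L (λ z → 𝟙 (does (z ≟ᴬ a))) ≡ 1) (f : A → A) where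

  open Iteration f

  count : (A → Bool) → ℕ
  count P = sumOver L (𝟙 ∘ P)

  orbit : A → ℕ → A → Bool
  orbit x zero    z = false
  orbit x (suc j) z = does (z ≟ᴬ iter j f x) ∨ orbit x j z

  orbit-sound : ∀ {x} j {z} → T (orbit x j z) → ∃ λ i → i < j × z ≡ iter i f x
  orbit-sound {x} (suc j) {z} z∈ with Equivalence.to T-∨ z∈
  ... | inj₁ z≡ = j , ≤-refl , does-sound (z ≟ᴬ iter j f x) z≡
  ... | inj₂ z∈′ = let i , i<j , z≡ = orbit-sound j z∈′ in i , m≤n⇒m≤1+n i<j , z≡

  orbit-complete : ∀ {x i} j → i < j → T (orbit x j (iter i f x))
  orbit-complete {x} {i} (suc j) i<1+j with m≤n⇒m<n∨m≡n (≤-pred i<1+j)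
  ... | inj₁ i<j  = Equivalence.from T-∨ (inj₂ (orbit-complete j i<j))
  ... | inj₂ refl = Equivalence.from T-∨ (inj₁ (does-complete (iter i f x ≟ᴬ iter i f x) refl))

  iterates-distinct : ∀ {p x i j} → ExactPeriod p x → i < j → j < p → iter j f x ≢ iter i f x
  iterates-distinct {p} {x} {i} {j} ep i<j j<p xj≡xi =
    ExactPeriod.minimal ep (m<n⇒0<n∸m i<j) (≤-<-trans (m∸n≤m j i) j<p) x-periodic
    where
    xi-periodic : Periodic (j ∸ i) (iter i f x)
    xi-periodic = trans (sym (iter-∸ (<⇒≤ i<j) x)) xj≡xi
    x-periodic : Periodic (j ∸ i) x
    x-periodic = subst (Periodic (j ∸ i))
      (periodic-return (<⇒≤ (<-trans i<j j<p)) (ExactPeriod.periodic ep))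
      (periodic-iter {j ∸ i} xi-periodic (p ∸ i))

  count-orbit : ∀ {p x} → ExactPeriod p x → ∀ {j} → j ≤ p → count (orbit x j) ≡ j
  count-orbit ep {zero}  _   = sumOver-0 L λ _ → refl
  count-orbit {p} {x} ep {suc j} j<p = begin
    count (orbit x (suc j))
      ≡⟨ sumOver-cong L (λ z → 𝟙-∨ _ _ (disjoint z)) ⟩
    sumOver L (λ z → 𝟙 (does (z ≟ᴬ iter j f x)) + 𝟙 (orbit x j z))
      ≡⟨ sumOver-+ L _ _ ⟩
    sumOver L (λ z → 𝟙 (does (z ≟ᴬ iter j f x))) + count (orbit x j)
      ≡⟨ cong₂ _+_ (enumerates (iter j f x)) (count-orbit ep (<⇒≤ j<p)) ⟩
    1 + j ∎
    where
    disjoint : ∀ z → ¬ (T (does (z ≟ᴬ iter j f x)) × T (orbit x j z))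
    disjoint z (z≡xj , z∈) with i , i<j , z≡xi ← orbit-sound j z∈ =
      iterates-distinct ep i<j j<p (trans (sym (does-sound (z ≟ᴬ iter j f x) z≡xj)) z≡xi)

  orbit-closed : ∀ {p x} → ExactPeriod p x → ∀ i → T (orbit x p (iter i f x))
  orbit-closed {p} {x} ep i =
    subst (T ∘ orbit x p) (sym (periodic-% periodic i)) (orbit-complete p (m%n<n i p))
    where
    open ExactPeriod ep
    instance
      p≢0 : NonZero p
      p≢0 = >-nonZero period>0

  orbit-predecessor : ∀ {p x z} → ExactPeriod p x → ExactPeriod p z →
                      T (orbit x p (f z)) → T (orbit x p z)
  orbit-predecessor {p} {x} {z} epˣ epᶻ fz∈ with i , _ , fz≡xi ← orbit-sound p fz∈ =
    subst (T ∘ orbit x p) xi′≡z (orbit-closed epˣ (p ∸ 1 + i))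
    where
    xi′≡z : iter (p ∸ 1 + i) f x ≡ z
    xi′≡z = begin
      iter (p ∸ 1 + i) f x        ≡⟨ iter-+ (p ∸ 1) i x ⟩
      iter (p ∸ 1) f (iter i f x) ≡⟨ cong (iter (p ∸ 1) f) fz≡xi ⟨
      iter (p ∸ 1) f (iter 1 f z) ≡⟨ periodic-return (period>0 epᶻ) (periodic epᶻ) ⟩
      z                           ∎
      where open ExactPeriod

  -- Induction on a bound N for count P: deleting the orbit of a P-point removes exactly p
  -- points and leaves an f-closed set, because a point of period p whose image lies in the
  -- orbit lies there as well.
  exactPeriod-∣-count : ∀ {p} N (P : A → Bool) → count P ≤ N →
    (∀ {z} → T (P z) → ExactPeriod p z) → (∀ {z} → T (P z) → T (P (f z))) → p ∣ count P
  exactPeriod-∣-count {p} zero P count≤0 _ _ = subst (p ∣_) (sym (n≤0⇒n≡0 count≤0)) (p ∣0)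
  exactPeriod-∣-count {p} (suc N) P count≤ ep closed with count P ≟ 0
  ... | yes count≡0 = subst (p ∣_) (sym count≡0) (p ∣0)
  ... | no count≢0  = subst (p ∣_) (sym split)
                        (∣m∣n⇒∣m+n (exactPeriod-∣-count N P′ rest≤N ep′ closed′) ∣-refl)
    where
    witness = sumOver-𝟙-witness L P count≢0
    x = proj₁ witness
    epˣ = ep (proj₂ witness)
    O = orbit x p
    P′ : A → Bool
    P′ z = P z ∧ not (O z)

    P-iter : ∀ i → T (P (iter i f x))
    P-iter zero    = proj₂ witness
    P-iter (suc i) = closed (P-iter i)

    O⊆P : ∀ {z} → T (O z) → T (P z)
    O⊆P z∈ with i , _ , z≡xi ← orbit-sound p z∈ = subst (T ∘ P) (sym z≡xi) (P-iter i)

    split : count P ≡ count P′ + p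
    split = begin
      count P
        ≡⟨ sumOver-cong L (λ z → 𝟙-∧-not (P z) (O z)) ⟩
      sumOver L (λ z → 𝟙 (P′ z) + 𝟙 (P z ∧ O z))
        ≡⟨ sumOver-+ L _ _ ⟩
      count P′ + count (λ z → P z ∧ O z)
        ≡⟨ cong (count P′ +_) (sumOver-cong L λ z → 𝟙-∧-redundant (P z) (O z) O⊆P) ⟩
      count P′ + count O
        ≡⟨ cong (count P′ +_) (count-orbit epˣ ≤-refl) ⟩
      count P′ + p ∎

    rest≤N : count P′ ≤ N
    rest≤N = ≤-pred (≤-trans (subst (count P′ <_) (sym split) (m<m+n _ (ExactPeriod.period>0 epˣ)))
                             count≤)

    ep′ : ∀ {z} → T (P′ z) → ExactPeriod p z
    ep′ z∈ = ep (proj₁ (Equivalence.to (T-∧-not _ _) z∈))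

    closed′ : ∀ {z} → T (P′ z) → T (P′ (f z))
    closed′ {z} z∈ with Pz , z∉O ← Equivalence.to (T-∧-not (P z) (O z)) z∈ =
      Equivalence.from (T-∧-not _ _) (closed Pz , z∉O ∘ orbit-predecessor epˣ (ep Pz))

xorSum-cong : ∀ {n} {f g : Fin n → Bool} → (∀ i → f i ≡ g i) → xorSum f ≡ xorSum g
xorSum-cong {zero}  f≗g = refl
xorSum-cong {suc n} f≗g = cong₂ _xor_ (f≗g Fin.zero) (xorSum-cong (f≗g ∘ Fin.suc))

xorSum-false : ∀ {n} {f : Fin n → Bool} → (∀ i → f i ≡ false) → xorSum f ≡ false
xorSum-false {zero}  f≗0 = refl
xorSum-false {suc n} f≗0 = cong₂ _xor_ (f≗0 Fin.zero) (xorSum-false (f≗0 ∘ Fin.suc))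

xorSum-++ : ∀ {n₁ n₂} (f : Fin (n₁ + n₂) → Bool) →
  xorSum f ≡ xorSum (f ∘ (_↑ˡ n₂)) xor xorSum (f ∘ (n₁ ↑ʳ_))
xorSum-++ {zero}       f = refl
xorSum-++ {suc n₁} {n₂} f =
  trans (cong (f Fin.zero xor_) (xorSum-++ {n₁} (f ∘ Fin.suc))) (sym (xor-assoc (f Fin.zero) _ _))

xorSum-++-falseʳ : ∀ {n₁ n₂} (f : Fin (n₁ + n₂) → Bool) →
  (∀ j → f (n₁ ↑ʳ j) ≡ false) → xorSum f ≡ xorSum (f ∘ (_↑ˡ n₂))
xorSum-++-falseʳ {n₁} {n₂} f right≡0 = trans (xorSum-++ {n₁} f)
  (trans (cong (xorSum (f ∘ (_↑ˡ n₂)) xor_) (xorSum-false right≡0)) (xor-identityʳ _))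

xorSum-++-falseˡ : ∀ {n₁ n₂} (f : Fin (n₁ + n₂) → Bool) →
  (∀ i → f (i ↑ˡ n₂) ≡ false) → xorSum f ≡ xorSum (f ∘ (n₁ ↑ʳ_))
xorSum-++-falseˡ {n₁} {n₂} f left≡0 =
  trans (xorSum-++ {n₁} f) (cong (_xor xorSum (f ∘ (n₁ ↑ʳ_))) (xorSum-false left≡0))

tabulate-++ : ∀ {n₁ n₂} (h : Fin (n₁ + n₂) → A) →
  tabulate h ≡ tabulate (h ∘ (_↑ˡ n₂)) ++ tabulate (h ∘ (n₁ ↑ʳ_))
tabulate-++ {n₁ = zero}         h = refl
tabulate-++ {n₁ = suc n₁} {n₂} h =
  cong (h Fin.zero ∷_) (tabulate-++ {n₁ = n₁} (h ∘ Fin.suc))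

⌊⌋-⇔ : ∀ {P Q : Set} → P ⇔ Q → (P? : Dec P) (Q? : Dec Q) → ⌊ P? ⌋ ≡ ⌊ Q? ⌋
⌊⌋-⇔ P⇔Q P? Q? = trans (isYes≗does P?) (trans (does-⇔ P⇔Q P? Q?) (sym (isYes≗does Q?)))

⌊⌋≡false : ∀ {P : Set} (P? : Dec P) → ¬ P → ⌊ P? ⌋ ≡ false
⌊⌋≡false P? ¬p = trans (isYes≗does P?) (dec-false P? ¬p)

↑ˡ≢↑ʳ : ∀ {n₁ n₂} (i : Fin n₁) (j : Fin n₂) → i ↑ˡ n₂ ≢ n₁ ↑ʳ j
↑ˡ≢↑ʳ {n₁} {n₂} i j eq
  with () ← trans (sym (splitAt-↑ˡ n₁ i n₂)) (trans (cong (splitAt n₁) eq) (splitAt-↑ʳ n₁ n₂ j))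

-- Counting states by exact period

sumOver-allStates-suc : ∀ n (g : State (suc n) → ℕ) →
  sumOver (allStates (suc n)) g ≡
  sumOver (allStates n) (g ∘ (true ∷_)) + sumOver (allStates n) (g ∘ (false ∷_))
sumOver-allStates-suc n g = trans (sumOver-++ (map (true ∷_) (allStates n)) _ g)
  (cong₂ _+_ (sumOver-map (true ∷_) (allStates n) g) (sumOver-map (false ∷_) (allStates n) g))

sumOver-allStates-++ : ∀ n₁ n₂ (g : State (n₁ + n₂) → ℕ) →
  sumOver (allStates (n₁ + n₂)) g ≡
  sumOver (allStates n₁) λ x → sumOver (allStates n₂) λ y → g (x ++ y)
sumOver-allStates-++ zero     n₂ g = sym (+-identityʳ _)
sumOver-allStates-++ (suc n₁) n₂ g = begin
  sumOver (allStates (suc n₁ + n₂)) g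
    ≡⟨ sumOver-allStates-suc (n₁ + n₂) g ⟩
  sumOver (allStates (n₁ + n₂)) (g ∘ (true ∷_)) + sumOver (allStates (n₁ + n₂)) (g ∘ (false ∷_))
    ≡⟨ cong₂ _+_ (sumOver-allStates-++ n₁ n₂ _) (sumOver-allStates-++ n₁ n₂ _) ⟩
  sumOver (allStates n₁) (λ x → sumOver (allStates n₂) λ y → g (true ∷ x ++ y)) +
  sumOver (allStates n₁) (λ x → sumOver (allStates n₂) λ y → g (false ∷ x ++ y))
    ≡⟨ sumOver-allStates-suc n₁ _ ⟨
  sumOver (allStates (suc n₁)) (λ x → sumOver (allStates n₂) λ y → g (x ++ y)) ∎

allStates-enumerates : ∀ n (o : State n) →
  sumOver (allStates n) (λ z → 𝟙 (does (≡-dec _≟ᴮ_ z o))) ≡ 1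
allStates-enumerates zero    []          = refl
allStates-enumerates (suc n) (true ∷ o)  = trans (sumOver-allStates-suc n _)
  (cong₂ _+_ (allStates-enumerates n o) (sumOver-0 (allStates n) λ _ → refl))
allStates-enumerates (suc n) (false ∷ o) = trans (sumOver-allStates-suc n _)
  (cong₂ _+_ (sumOver-0 (allStates n) λ _ → refl) (allStates-enumerates n o))

∈-allStates : ∀ {n} (x : State n) → x ∈ allStates n
∈-allStates []          = here refl
∈-allStates (true ∷ x)  = ∈-++⁺ˡ (∈-map⁺ (true ∷_) (∈-allStates x))
∈-allStates (false ∷ x) =
  ∈-++⁺ʳ (map (true ∷_) (allStates _)) (∈-map⁺ (false ∷_) (∈-allStates x))

periodCount : ∀ {n} → Graph n → ℕ → ℕ
periodCount {n} G i = sumOver (allStates n) (𝟙 ∘ exactPeriod G i)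

module LoopVertices {n} (G : Graph n) where

  open Iteration (harm G)

  exactPeriod-sound : ∀ i x → T (exactPeriod G i x) → ExactPeriod i x
  exactPeriod-sound (suc i) x t with returns , neverBefore ← Equivalence.to T-∧ t = record
    { period>0 = z<s
    ; periodic = toWitness returns
    ; minimal  = λ { {suc j} _ (s<s j<i) →
        toWitnessFalse (All.lookup (all⁺ _ (upTo i) neverBefore) (∈-upTo⁺ j<i)) }
    }

  exactPeriod-complete : ∀ {i x} → ExactPeriod i x → T (exactPeriod G i x)
  exactPeriod-complete {zero}  ep = contradiction (ExactPeriod.period>0 ep) (λ ())
  exactPeriod-complete {suc i} ep = Equivalence.from T-∧
    ( fromWitness periodic
    , all⁻ _ (All.tabulate λ j∈ → fromWitnessFalse (minimal z<s (s<s (∈-upTo⁻ j∈)))))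
    where open ExactPeriod ep

  -- So restricting to Im π in loopVertices is vacuous, and L(G) does not depend on (k, m).
  exactPeriod-inImage : ∀ k m {i x} → T (exactPeriod G i x) → T (inImage G k m x)
  exactPeriod-inImage k m {suc i} {x} t =
    any⁺ _ (lose (∈-allStates preimage) (fromWitness π[preimage]≡x))
    where
    preimage = iter (i * (m * k)) (harm G) x
    π[preimage]≡x : proj G k m preimage ≡ x
    π[preimage]≡x =
      periodic-∈-image {i} {x} (ExactPeriod.periodic (exactPeriod-sound (suc i) x t)) (m * k)

  loopVertices≡periodCount : ∀ k m i → loopVertices G k m i ≡ periodCount G i
  loopVertices≡periodCount k m i =
    trans (length-filter-T? (λ x → inImage G k m x ∧ exactPeriod G i x) (allStates n))
          (sumOver-cong (allStates n) λ x → 𝟙-∧-redundant _ _ (exactPeriod-inImage k m {i} {x}))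

  period∣periodCount : ∀ p → p ∣ periodCount G p
  period∣periodCount p = exactPeriod-∣-count (periodCount G p) (exactPeriod G p) ≤-refl
    (λ {z} → exactPeriod-sound p z)
    (λ {z} t → exactPeriod-complete (exactPeriod-iter (exactPeriod-sound p z t) 1))
    where open OrbitCounting (≡-dec _≟ᴮ_) (allStates n) (allStates-enumerates n) (harm G)

-- Kernels of powers of the harmonic operator

zeroState-++ : ∀ n₁ n₂ → zeroState (n₁ + n₂) ≡ zeroState n₁ ++ zeroState n₂
zeroState-++ zero     n₂ = refl
zeroState-++ (suc n₁) n₂ = cong (false ∷_) (zeroState-++ n₁ n₂)

harm-zero : ∀ {n} (G : Graph n) → harm G (zeroState n) ≡ zeroState n
harm-zero {n} G = begin
  tabulate (λ i → xorSum (λ j → harmMatrix G i j ∧ lookup (zeroState n) j))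
    ≡⟨ tabulate-cong (λ i → xorSum-false λ j →
         trans (cong (harmMatrix G i j ∧_) (lookup-replicate j false)) (∧-zeroʳ _)) ⟩
  tabulate (λ _ → false)
    ≡⟨ tabulate-const n false ⟩
  zeroState n ∎
  where
  tabulate-const : ∀ n (b : Bool) → tabulate {n = n} (λ _ → b) ≡ replicate n b
  tabulate-const zero    b = refl
  tabulate-const (suc n) b = cong (b ∷_) (tabulate-const n b)

kernel-stable : ∀ {n} {G : Graph n} {k m} → IsMinPreperiodPeriod G k m →
  ∀ K x {K′} → iter K (harm G) x ≡ zeroState n → k ≤ K′ → iter K′ (harm G) x ≡ zeroState n
kernel-stable {G = G} {k} {m} H =
  Iteration.eventually-fixed (harm G) {k} {m} m≥1 powEq (harm-zero G)
  where open IsMinPreperiodPeriod H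

preperiod≤proj-exponent : ∀ {n} {G : Graph n} {k m} → IsMinPreperiodPeriod G k m → k ≤ m * k
preperiod≤proj-exponent {k = k} {m} H = m≤n*m k m {{>-nonZero (IsMinPreperiodPeriod.m≥1 H)}}

kernelVertex-≡ : ∀ {n} {π : State n → State n} {x x′ : State n}
  {πx≡0 : π x ≡ zeroState n} {πx′≡0 : π x′ ≡ zeroState n} →
  x ≡ x′ → _≡_ {A = Σ (State n) λ z → π z ≡ zeroState n} (x , πx≡0) (x′ , πx′≡0)
kernelVertex-≡ refl = cong (_ ,_) (Decidable⇒UIP.≡-irrelevant (≡-dec _≟ᴮ_) _ _)

take-drop-++ : ∀ {n₁ n₂} (x : Vec A n₁) (y : Vec A n₂) →
  take n₁ (x ++ y) ≡ x × drop n₁ (x ++ y) ≡ y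
take-drop-++ {n₁ = n₁} x y = ++-injective _ x (take++drop≡id n₁ (x ++ y))

-- Disjoint unions

module DisjointUnion {n₁ n₂} (G₁ : Graph n₁) (G₂ : Graph n₂) where

  U : Graph (n₁ + n₂)
  U = G₁ ⊕ G₂

  adj-↑ˡ-↑ˡ : ∀ i j → adj U (i ↑ˡ n₂) (j ↑ˡ n₂) ≡ adj G₁ i j
  adj-↑ˡ-↑ˡ i j rewrite splitAt-↑ˡ n₁ i n₂ | splitAt-↑ˡ n₁ j n₂ = refl

  adj-↑ˡ-↑ʳ : ∀ i j → adj U (i ↑ˡ n₂) (n₁ ↑ʳ j) ≡ false
  adj-↑ˡ-↑ʳ i j rewrite splitAt-↑ˡ n₁ i n₂ | splitAt-↑ʳ n₁ n₂ j = refl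

  adj-↑ʳ-↑ˡ : ∀ i j → adj U (n₁ ↑ʳ i) (j ↑ˡ n₂) ≡ false
  adj-↑ʳ-↑ˡ i j rewrite splitAt-↑ʳ n₁ n₂ i | splitAt-↑ˡ n₁ j n₂ = refl

  adj-↑ʳ-↑ʳ : ∀ i j → adj U (n₁ ↑ʳ i) (n₁ ↑ʳ j) ≡ adj G₂ i j
  adj-↑ʳ-↑ʳ i j rewrite splitAt-↑ʳ n₁ n₂ i | splitAt-↑ʳ n₁ n₂ j = refl

  oddDeg-↑ˡ : ∀ i → oddDeg U (i ↑ˡ n₂) ≡ oddDeg G₁ i
  oddDeg-↑ˡ i =
    trans (xorSum-++-falseʳ {n₁} _ (adj-↑ˡ-↑ʳ i)) (xorSum-cong (adj-↑ˡ-↑ˡ i))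

  oddDeg-↑ʳ : ∀ i → oddDeg U (n₁ ↑ʳ i) ≡ oddDeg G₂ i
  oddDeg-↑ʳ i =
    trans (xorSum-++-falseˡ {n₁} _ (adj-↑ʳ-↑ˡ i)) (xorSum-cong (adj-↑ʳ-↑ʳ i))

  harmMatrix-↑ˡ-↑ˡ : ∀ i j → harmMatrix U (i ↑ˡ n₂) (j ↑ˡ n₂) ≡ harmMatrix G₁ i j
  harmMatrix-↑ˡ-↑ˡ i j = cong₂ _xor_ (adj-↑ˡ-↑ˡ i j) (cong₂ _∧_
    (⌊⌋-⇔ (mk⇔ (↑ˡ-injective n₂ i j) (cong (_↑ˡ n₂))) (i ↑ˡ n₂ ≟ᶠ j ↑ˡ n₂) (i ≟ᶠ j))
    (oddDeg-↑ˡ i))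

  harmMatrix-↑ʳ-↑ʳ : ∀ i j → harmMatrix U (n₁ ↑ʳ i) (n₁ ↑ʳ j) ≡ harmMatrix G₂ i j
  harmMatrix-↑ʳ-↑ʳ i j = cong₂ _xor_ (adj-↑ʳ-↑ʳ i j) (cong₂ _∧_
    (⌊⌋-⇔ (mk⇔ (↑ʳ-injective n₁ i j) (cong (n₁ ↑ʳ_))) (n₁ ↑ʳ i ≟ᶠ n₁ ↑ʳ j) (i ≟ᶠ j))
    (oddDeg-↑ʳ i))

  harmMatrix-↑ˡ-↑ʳ : ∀ i j → harmMatrix U (i ↑ˡ n₂) (n₁ ↑ʳ j) ≡ false
  harmMatrix-↑ˡ-↑ʳ i j = cong₂ _xor_ (adj-↑ˡ-↑ʳ i j)
    (cong (_∧ oddDeg U (i ↑ˡ n₂)) (⌊⌋≡false (i ↑ˡ n₂ ≟ᶠ n₁ ↑ʳ j) (↑ˡ≢↑ʳ i j)))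

  harmMatrix-↑ʳ-↑ˡ : ∀ i j → harmMatrix U (n₁ ↑ʳ i) (j ↑ˡ n₂) ≡ false
  harmMatrix-↑ʳ-↑ˡ i j = cong₂ _xor_ (adj-↑ʳ-↑ˡ i j)
    (cong (_∧ oddDeg U (n₁ ↑ʳ i)) (⌊⌋≡false (n₁ ↑ʳ i ≟ᶠ j ↑ˡ n₂) (↑ˡ≢↑ʳ j i ∘ sym)))

  harm-++ : ∀ x y → harm U (x ++ y) ≡ harm G₁ x ++ harm G₂ y
  harm-++ x y = trans (tabulate-++ {n₁ = n₁} _)
                      (cong₂ _++_ (tabulate-cong row-↑ˡ) (tabulate-cong row-↑ʳ))
    where
    entry : Fin (n₁ + n₂) → Fin (n₁ + n₂) → Bool
    entry r j = harmMatrix U r j ∧ lookup (x ++ y) j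

    row-↑ˡ : ∀ i → xorSum (entry (i ↑ˡ n₂)) ≡ xorSum (λ j → harmMatrix G₁ i j ∧ lookup x j)
    row-↑ˡ i = trans
      (xorSum-++-falseʳ {n₁} _ λ j → cong (_∧ lookup (x ++ y) (n₁ ↑ʳ j)) (harmMatrix-↑ˡ-↑ʳ i j))
      (xorSum-cong λ j → cong₂ _∧_ (harmMatrix-↑ˡ-↑ˡ i j) (lookup-++ˡ x y j))

    row-↑ʳ : ∀ i → xorSum (entry (n₁ ↑ʳ i)) ≡ xorSum (λ j → harmMatrix G₂ i j ∧ lookup y j)
    row-↑ʳ i = trans
      (xorSum-++-falseˡ {n₁} _ λ j → cong (_∧ lookup (x ++ y) (j ↑ˡ n₂)) (harmMatrix-↑ʳ-↑ˡ i j))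
      (xorSum-cong λ j → cong₂ _∧_ (harmMatrix-↑ʳ-↑ʳ i j) (lookup-++ʳ x y j))

  iter-++ : ∀ t x y → iter t (harm U) (x ++ y) ≡ iter t (harm G₁) x ++ iter t (harm G₂) y
  iter-++ zero    x y = refl
  iter-++ (suc t) x y = trans (cong (harm U) (iter-++ t x y))
                              (harm-++ (iter t (harm G₁) x) (iter t (harm G₂) y))

  open Product (harm G₁) (harm G₂) (harm U) _++_ (λ {x} {x′} → ++-injective x x′) iter-++ public

  harm-take-drop : ∀ z → harm U z ≡ harm G₁ (take n₁ z) ++ harm G₂ (drop n₁ z)
  harm-take-drop z =
    trans (cong (harm U) (sym (take++drop≡id n₁ z))) (harm-++ (take n₁ z) (drop n₁ z))

  harm≡⇔ : ∀ z w → harm U z ≡ w ⇔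
                   (harm G₁ (take n₁ z) ≡ take n₁ w × harm G₂ (drop n₁ z) ≡ drop n₁ w)
  harm≡⇔ z w = mk⇔
    (λ az≡w → ++-injective _ _
       (trans (sym (harm-take-drop z)) (trans az≡w (sym (take++drop≡id n₁ w)))))
    (λ (e₁ , e₂) → trans (harm-take-drop z) (trans (cong₂ _++_ e₁ e₂) (take++drop≡id n₁ w)))

  module _ {k₁ m₁ k₂ m₂ k m} (H₁ : IsMinPreperiodPeriod G₁ k₁ m₁)
           (H₂ : IsMinPreperiodPeriod G₂ k₂ m₂) (H : IsMinPreperiodPeriod U k m) where

    open IsMinPreperiodPeriod H using (m≥1; powEq)

    preperiod₁≤ : k₁ ≤ m * k
    preperiod₁≤ = ≤-trans
      (proj₁ (IsMinPreperiodPeriod.minimal H₁ k m m≥1 (iterEq-⊕ˡ (k + m) k (zeroState n₂) powEq)))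
      (preperiod≤proj-exponent H)

    preperiod₂≤ : k₂ ≤ m * k
    preperiod₂≤ = ≤-trans
      (proj₁ (IsMinPreperiodPeriod.minimal H₂ k m m≥1 (iterEq-⊕ʳ (k + m) k (zeroState n₁) powEq)))
      (preperiod≤proj-exponent H)

    proj-++≡0⇔ : ∀ x y → proj U k m (x ++ y) ≡ zeroState (n₁ + n₂) ⇔
                         (proj G₁ k₁ m₁ x ≡ zeroState n₁ × proj G₂ k₂ m₂ y ≡ zeroState n₂)
    proj-++≡0⇔ x y = mk⇔
      (λ πxy≡0 →
        let πx≡0 , πy≡0 = ++-injective _ _
              (trans (sym (iter-++ (m * k) x y)) (trans πxy≡0 (zeroState-++ n₁ n₂)))
        in kernel-stable H₁ (m * k) x πx≡0 (preperiod≤proj-exponent H₁) ,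
           kernel-stable H₂ (m * k) y πy≡0 (preperiod≤proj-exponent H₂))
      (λ (πx≡0 , πy≡0) → begin
        iter (m * k) (harm U) (x ++ y)
          ≡⟨ iter-++ (m * k) x y ⟩
        iter (m * k) (harm G₁) x ++ iter (m * k) (harm G₂) y
          ≡⟨ cong₂ _++_ (kernel-stable H₁ (m₁ * k₁) x πx≡0 preperiod₁≤)
                        (kernel-stable H₂ (m₂ * k₂) y πy≡0 preperiod₂≤) ⟩
        zeroState n₁ ++ zeroState n₂
          ≡⟨ zeroState-++ n₁ n₂ ⟨
        zeroState (n₁ + n₂) ∎)

    charTree-⊕ : charTree U k m ≅ (charTree G₁ k₁ m₁ ⊗ charTree G₂ k₂ m₂)
    charTree-⊕ = mk↔ₛ′ split join split∘join join∘split , λ v w → harm≡⇔ (proj₁ v) (proj₁ w)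
      where
      split : Vtx (charTree U k m) → Vtx (charTree G₁ k₁ m₁ ⊗ charTree G₂ k₂ m₂)
      split (z , πz≡0) =
        let πx≡0 , πy≡0 = Equivalence.to (proj-++≡0⇔ (take n₁ z) (drop n₁ z)) πz≡0′
        in (take n₁ z , πx≡0) , (drop n₁ z , πy≡0)
        where
        πz≡0′ : proj U k m (take n₁ z ++ drop n₁ z) ≡ zeroState (n₁ + n₂)
        πz≡0′ = subst (λ w → proj U k m w ≡ zeroState (n₁ + n₂)) (sym (take++drop≡id n₁ z)) πz≡0

      join : Vtx (charTree G₁ k₁ m₁ ⊗ charTree G₂ k₂ m₂) → Vtx (charTree U k m)
      join ((x , πx≡0) , (y , πy≡0)) = x ++ y , Equivalence.from (proj-++≡0⇔ x y) (πx≡0 , πy≡0)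

      split∘join : ∀ w → split (join w) ≡ w
      split∘join ((x , _) , (y , _)) =
        let take≡x , drop≡y = take-drop-++ x y
        in cong₂ _,_ (kernelVertex-≡ take≡x) (kernelVertex-≡ drop≡y)

      join∘split : ∀ v → join (split v) ≡ v
      join∘split (z , _) = kernelVertex-≡ (take++drop≡id n₁ z)

  private
    module IU = Iteration (harm U)
    module I₁ = Iteration (harm G₁)
    module I₂ = Iteration (harm G₂)
    module L₁ = LoopVertices G₁
    module L₂ = LoopVertices G₂
    module LU = LoopVertices U

  lcmTerm : ℕ → State n₁ → State n₂ → ℕ → ℕ → ℕ
  lcmTerm c x y a b = 𝟙 ⌊ lcm a b ≟ c ⌋ * (𝟙 (exactPeriod G₁ a x) * 𝟙 (exactPeriod G₂ b y))

  lcmTerm≡0 : ∀ c x y a b →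
    ¬ (T ⌊ lcm a b ≟ c ⌋ × T (exactPeriod G₁ a x) × T (exactPeriod G₂ b y)) →
    lcmTerm c x y a b ≡ 0
  lcmTerm≡0 c x y a b = 𝟙*𝟙*𝟙≡0 ⌊ lcm a b ≟ c ⌋ (exactPeriod G₁ a x) (exactPeriod G₂ b y)

  lcmTerms-aperiodic : ∀ c x y → ¬ IU.ExactPeriod c (x ++ y) →
                       (sum1to c λ a → sum1to c (lcmTerm c x y a)) ≡ 0
  lcmTerms-aperiodic c x y ¬ep = sum1to-0 c λ {a} _ _ → sum1to-0 c λ {b} _ _ →
    lcmTerm≡0 c x y a b λ (lcm≡c , epˣ , epʸ) →
      ¬ep (subst (λ c′ → IU.ExactPeriod c′ (x ++ y)) (toWitness lcm≡c)
                 (exactPeriod-⊕ (L₁.exactPeriod-sound a x epˣ) (L₂.exactPeriod-sound b y epʸ)))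

  lcmTerms-exact : ∀ {c x y p q} → I₁.ExactPeriod p x → I₂.ExactPeriod q y → lcm p q ≡ c →
                   (sum1to c λ a → sum1to c (lcmTerm c x y a)) ≡ 1
  lcmTerms-exact {c} {x} {y} {p} {q} epˣ epʸ lcm≡c = begin
    sum1to c (λ a → sum1to c (lcmTerm c x y a))
      ≡⟨ sum1to-concentrated c p>0 (∣lcm⇒≤c (m∣lcm[m,n] p q)) (λ {a} _ _ a≢p →
           sum1to-0 c λ {b} _ _ → lcmTerm≡0 c x y a b λ (_ , epᵃ , _) →
             a≢p (I₁.exactPeriod-unique (L₁.exactPeriod-sound a x epᵃ) epˣ)) ⟩
    sum1to c (lcmTerm c x y p)
      ≡⟨ sum1to-concentrated c q>0 (∣lcm⇒≤c (n∣lcm[m,n] p q)) (λ {b} _ _ b≢q →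
           lcmTerm≡0 c x y p b λ (_ , _ , epᵇ) →
             b≢q (I₂.exactPeriod-unique (L₂.exactPeriod-sound b y epᵇ) epʸ)) ⟩
    lcmTerm c x y p q
      ≡⟨ cong₂ _*_ (𝟙-true (fromWitness {a? = lcm p q ≟ c} lcm≡c))
                   (cong₂ _*_ (𝟙-true (L₁.exactPeriod-complete {p} {x} epˣ))
                              (𝟙-true (L₂.exactPeriod-complete {q} {y} epʸ))) ⟩
    1 ∎
    where
    p>0 = I₁.ExactPeriod.period>0 epˣ
    q>0 = I₂.ExactPeriod.period>0 epʸ
    ∣lcm⇒≤c : ∀ {d} → d ∣ lcm p q → d ≤ c
    ∣lcm⇒≤c d∣lcm = subst (_ ≤_) lcm≡c (∣⇒≤ {{>-nonZero (lcm-positive p>0 q>0)}} d∣lcm)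

  lcmTerms-periodic : ∀ c x y → IU.ExactPeriod c (x ++ y) →
                      (sum1to c λ a → sum1to c (lcmTerm c x y a)) ≡ 1
  lcmTerms-periodic c x y ep =
    let p , q , epˣ , epʸ , lcm≡c = exactPeriod-⊕⁻ (≡-dec _≟ᴮ_) (≡-dec _≟ᴮ_) {c} {x} {y} ep
    in lcmTerms-exact epˣ epʸ lcm≡c

  𝟙-exactPeriod-++ : ∀ c x y →
    𝟙 (exactPeriod U c (x ++ y)) ≡ sum1to c λ a → sum1to c (lcmTerm c x y a)
  𝟙-exactPeriod-++ c x y with exactPeriod U c (x ++ y) in ep≡
  ... | false = sym (lcmTerms-aperiodic c x y λ ep → subst T ep≡ (LU.exactPeriod-complete ep))
  ... | true  = sym (lcmTerms-periodic c x y
                       (LU.exactPeriod-sound c (x ++ y) (subst T (sym ep≡) _)))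

  periodCount-⊕ : ∀ c → periodCount U c ≡ sum1to c λ a → sum1to c λ b →
                          𝟙 ⌊ lcm a b ≟ c ⌋ * (periodCount G₁ a * periodCount G₂ b)
  periodCount-⊕ c = begin
    periodCount U c
      ≡⟨ sumOver-allStates-++ n₁ n₂ (𝟙 ∘ exactPeriod U c) ⟩
    sumOver S₁ (λ x → sumOver S₂ λ y → 𝟙 (exactPeriod U c (x ++ y)))
      ≡⟨ sumOver-cong S₁ (λ x → trans (sumOver-cong S₂ (𝟙-exactPeriod-++ c x))
                                      (sumOver-sum1to²-comm S₂ c λ y → lcmTerm c x y)) ⟩
    sumOver S₁ (λ x → sum1to c λ a → sum1to c λ b → sumOver S₂ λ y → lcmTerm c x y a b)
      ≡⟨ sumOver-sum1to²-comm S₁ c (λ x a b → sumOver S₂ λ y → lcmTerm c x y a b) ⟩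
    (sum1to c λ a → sum1to c λ b → sumOver S₁ λ x → sumOver S₂ λ y → lcmTerm c x y a b)
      ≡⟨ sum1to-cong c (λ {a} _ _ → sum1to-cong c λ {b} _ _ → sumOver-*-sumOver S₁ S₂
           (𝟙 ⌊ lcm a b ≟ c ⌋) (𝟙 ∘ exactPeriod G₁ a) (𝟙 ∘ exactPeriod G₂ b)) ⟩
    (sum1to c λ a → sum1to c λ b → 𝟙 ⌊ lcm a b ≟ c ⌋ * (periodCount G₁ a * periodCount G₂ b)) ∎
    where
    S₁ = allStates n₁
    S₂ = allStates n₂

  loopEnsemble-⊕ : ∀ k m k₁ m₁ k₂ m₂ i →
    loopEnsemble U k m i ≡ (loopEnsemble G₁ k₁ m₁ ⊛ loopEnsemble G₂ k₂ m₂) i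
  loopEnsemble-⊕ k m k₁ m₁ k₂ m₂ zero      = refl
  loopEnsemble-⊕ k m k₁ m₁ k₂ m₂ c@(suc _) = begin
    loopVertices U k m c / c
      ≡⟨ cong (_/ c) (trans (LU.loopVertices≡periodCount k m c) (periodCount-⊕ c)) ⟩
    lcmWeightedCount / c
      ≡⟨ cong (_/ c) c*coefficient ⟨
    c * (ℒ₁ ⊛ ℒ₂) c / c
      ≡⟨ cong (_/ c) (*-comm c ((ℒ₁ ⊛ ℒ₂) c)) ⟩
    (ℒ₁ ⊛ ℒ₂) c * c / c
      ≡⟨ m*n/n≡m ((ℒ₁ ⊛ ℒ₂) c) c ⟩
    (ℒ₁ ⊛ ℒ₂) c ∎
    where
    ℒ₁ = loopEnsemble G₁ k₁ m₁
    ℒ₂ = loopEnsemble G₂ k₂ m₂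

    lcmWeightedCount : ℕ
    lcmWeightedCount = sum1to c λ a → sum1to c λ b →
      𝟙 ⌊ lcm a b ≟ c ⌋ * (periodCount G₁ a * periodCount G₂ b)

    c*summand : ∀ {a b} → 0 < a → 0 < b →
      c * (if ⌊ lcm a b ≟ c ⌋ then gcd a b * ℒ₁ a * ℒ₂ b else 0) ≡
      𝟙 ⌊ lcm a b ≟ c ⌋ * (periodCount G₁ a * periodCount G₂ b)
    c*summand {a@(suc _)} {b@(suc _)} _ _ with lcm a b ≟ c
    ... | no _      = *-zeroʳ c
    ... | yes lcm≡c = begin
      c * (gcd a b * ℒ₁ a * ℒ₂ b)
        ≡⟨ cong (_* (gcd a b * ℒ₁ a * ℒ₂ b)) lcm≡c ⟨
      lcm a b * (gcd a b * ℒ₁ a * ℒ₂ b)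
        ≡⟨ cong₂ (λ V₁ V₂ → lcm a b * (gcd a b * (V₁ / a) * (V₂ / b)))
                 (L₁.loopVertices≡periodCount k₁ m₁ a) (L₂.loopVertices≡periodCount k₂ m₂ b) ⟩
      lcm a b * (gcd a b * (periodCount G₁ a / a) * (periodCount G₂ b / b))
        ≡⟨ lcm*gcd*quotients a b (L₁.period∣periodCount a) (L₂.period∣periodCount b) ⟩
      periodCount G₁ a * periodCount G₂ b
        ≡⟨ *-identityˡ _ ⟨
      1 * (periodCount G₁ a * periodCount G₂ b) ∎

    c*coefficient : c * (ℒ₁ ⊛ ℒ₂) c ≡ lcmWeightedCount
    c*coefficient = trans (sym (sum1to-*ˡ c c _)) (sum1to-cong c λ a>0 _ →
                      trans (sym (sum1to-*ˡ c c _)) (sum1to-cong c λ b>0 _ → c*summand a>0 b>0))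

proposition8 : ∀ {n₁ n₂ : ℕ} (G₁ : Graph n₁) (G₂ : Graph n₂) →
    Simple G₁ → Simple G₂ →
    ∀ (k₁ m₁ k₂ m₂ k m : ℕ) →
    IsMinPreperiodPeriod G₁ k₁ m₁ →
    IsMinPreperiodPeriod G₂ k₂ m₂ →
    IsMinPreperiodPeriod (G₁ ⊕ G₂) k m →
    (charTree (G₁ ⊕ G₂) k m ≅ (charTree G₁ k₁ m₁ ⊗ charTree G₂ k₂ m₂))
    × (∀ (i : ℕ) → loopEnsemble (G₁ ⊕ G₂) k m i
                   ≡ (loopEnsemble G₁ k₁ m₁ ⊛ loopEnsemble G₂ k₂ m₂) i)
proposition8 G₁ G₂ _ _ k₁ m₁ k₂ m₂ k m H₁ H₂ H =
  charTree-⊕ H₁ H₂ H , loopEnsemble-⊕ k m k₁ m₁ k₂ m₂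
  where open DisjointUnion G₁ G₂
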